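{- Let $G$ be a finite simple graph and $r>2$ an integer. Then $$\rho_o(G)\leq \rho_o(G\square K_r)\leq \alpha_2(G).$$ Moreover, if $G$ is triangle-free and $\chi(G/S)\leq r$, where $S$ is an $\alpha_2(G)$-set, then $\rho_o(G\square K_r)=\alpha_2(G)$.
   Context: For a graph $G$, $N_G(v)$ is the open neighborhood of $v$. An open packing is a set $P\subseteq V(G)$ with $N_G(u)\cap N_G(v)=\emptyset$ for distinct $u,v\in P$; $\rho_o(G)$ is the maximum size of an open packing. A set $S\subseteq V(G)$ is 2-independent if the induced subgraph $G[S]$ has maximum degree less than $2$; $\alpha_2(G)$ is the maximum size of a 2-independent set, and an $\alpha_2(G)$-set is a 2-independent set of that size. For a 2-independent set $S$, the graph $G/S$ has as vertices the connected components of $G[S]$, two components $C,C'$ being adjacent iff $d_G(C,C')=2$, where $d_G(C,C')=\min\{d_G(x,y): x\in V(C), y\in V(C')\}$. $\chi$ denotes the chromatic number, $K_r$ the complete graph on $r$ vertices, and $G\square K_r$ the Cartesian product (vertex set $V(G)\times V(K_r)$, $(g,h)\sim(g',h')$ iff $g=g'$ and $hh'\in E(K_r)$, or $h=h'$ and $gg'\in E(G)$). -}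

module Defs where

open import Data.Nat using (ℕ; zero; suc; _*_; _<_; _⊔_)
open import Data.Nat.Properties using (_<?_)
open import Data.Fin using (Fin; remQuot; _≟_)
open import Data.Fin.Properties using (all?)
open import Data.Fin.Subset using (Subset; _∈_; _∩_; ∣_∣)
open import Data.Fin.Subset.Properties using (_∈?_)
open import Data.Bool using (Bool; true; false; _∧_; _∨_; not)
import Data.Bool as B
open import Data.Vec using (Vec; []; _∷_; tabulate)
open import Data.List using (List; []; _∷_; _++_; map; filter; foldr)
open import Data.Product using (_×_; _,_; ∃; ∃-syntax)
open import Data.Empty using (⊥)
open import Relation.Nullary using (¬_; Dec; yes; no)
open import Relation.Nullary.Decidable using (¬?; _→-dec_; ⌊_⌋)
open import Relation.Binary.PropositionalEquality using (_≡_; _≢_)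

Graph : ℕ → Set
Graph n = Fin n → Fin n → Bool

record IsSimple {n : ℕ} (G : Graph n) : Set where
  field
    sym     : ∀ u v → G u v ≡ G v u
    irrefl  : ∀ v → G v v ≡ false

N : ∀ {n} → Graph n → Fin n → Subset n
N G v = tabulate (G v)

maxList : List ℕ → ℕ
maxList = foldr _⊔_ 0

allSubsets : (n : ℕ) → List (Subset n)
allSubsets zero    = [] ∷ []
allSubsets (suc n) = map (true ∷_) (allSubsets n) ++ map (false ∷_) (allSubsets n)

IsOpenPacking : ∀ {n} → Graph n → Subset n → Set
IsOpenPacking G P =
  ∀ u v → u ∈ P → v ∈ P → u ≢ v →
    ∀ w → G u w ≡ true → G v w ≡ true → ⊥

isOpenPacking? : ∀ {n} (G : Graph n) (P : Subset n) → Dec (IsOpenPacking G P)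
isOpenPacking? G P =
  all? λ u → all? λ v → (u ∈? P) →-dec (v ∈? P) →-dec ¬? (u ≟ v) →-dec
    all? λ w → (G u w B.≟ true) →-dec (G v w B.≟ true) →-dec no (λ ())

ρo : ∀ {n} → Graph n → ℕ
ρo {n} G = maxList (map ∣_∣ (filter (isOpenPacking? G) (allSubsets n)))

-- 2-independent sets: G[S] has maximum degree < 2, i.e. every v ∈ S has
-- fewer than 2 neighbours inside S.

Is2Independent : ∀ {n} → Graph n → Subset n → Set
Is2Independent G S = ∀ v → v ∈ S → ∣ N G v ∩ S ∣ < 2

is2Independent? : ∀ {n} (G : Graph n) (S : Subset n) → Dec (Is2Independent G S)
is2Independent? G S = all? λ v → (v ∈? S) →-dec (∣ N G v ∩ S ∣ <? 2)

α₂ : ∀ {n} → Graph n → ℕ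
α₂ {n} G = maxList (map ∣_∣ (filter (is2Independent? G) (allSubsets n)))

Isα₂Set : ∀ {n} → Graph n → Subset n → Set
Isα₂Set G S = Is2Independent G S × ∣ S ∣ ≡ α₂ G

-- Cartesian product G □ K_r on Fin (n * r); the vertex i corresponds to
-- the pair remQuot r i = (g , h) ∈ V(G) × V(K_r)  (a bijection, cf.
-- Data.Fin.Properties.remQuot-combine / combine-remQuot).

K : (r : ℕ) → Graph r
K r h h' = not ⌊ h ≟ h' ⌋

_□_ : ∀ {n r} → Graph n → Graph r → Graph (n * r)
_□_ {n} {r} G H i j with remQuot {n} r i | remQuot {n} r j
... | (g , h) | (g' , h') = (⌊ g ≟ g' ⌋ ∧ H h h') ∨ (⌊ h ≟ h' ⌋ ∧ G g g')

TriangleFree : ∀ {n} → Graph n → Set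
TriangleFree G = ¬ (∃[ u ] ∃[ v ] ∃[ w ] (G u v ≡ true × G v w ≡ true × G u w ≡ true))

-- Distances: WithinDist G u v k  ⇔  d_G(u,v) ≤ k

data WithinDist {n} (G : Graph n) : Fin n → Fin n → ℕ → Set where
  here  : ∀ {u k} → WithinDist G u u k
  step  : ∀ {u w v k} → G u w ≡ true → WithinDist G w v k → WithinDist G u v (suc k)

-- Reach G S x y : x, y ∈ S and y lies in the connected component of x in G[S]
data Reach {n} (G : Graph n) (S : Subset n) : Fin n → Fin n → Set where
  here  : ∀ {x} → x ∈ S → Reach G S x x
  step  : ∀ {x w y} → x ∈ S → G x w ≡ true → Reach G S w y → Reach G S x y

-- A vertex of G/S (a component C of G[S]) is represented by
-- any of its vertices x ∈ S; its vertex set is {a | Reach G S x a}.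
-- Components C_x, C_y are adjacent in G/S iff d_G(C_x, C_y) = 2, i.e.
-- the minimum distance between their vertices is ≤ 2 but not ≤ 1.
QuotAdj : ∀ {n} → Graph n → Subset n → Fin n → Fin n → Set
QuotAdj G S x y =
  (∃[ a ] ∃[ b ] (Reach G S x a × Reach G S y b × WithinDist G a b 2)) ×
  ¬ (∃[ a ] ∃[ b ] (Reach G S x a × Reach G S y b × WithinDist G a b 1))

-- A proper r-colouring of G/S: a colour for each component (i.e. a map on
-- S that is constant on components), with adjacent components coloured
-- differently.  χ(G/S) ≤ r iff such a colouring exists.
record QuotColouring {n} (G : Graph n) (S : Subset n) (r : ℕ) : Set where
  field
    colour     : Fin n → Fin r
    wellDef    : ∀ x y → Reach G S x y → colour x ≡ colour y
    proper     : ∀ x y → x ∈ S → y ∈ S → QuotAdj G S x y → colour x ≢ colour y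

χQuot≤ : ∀ {n} → Graph n → Subset n → ℕ → Set
χQuot≤ G S r = QuotColouring G S r

-- Lower bound: an open packing of G copied into one layer G × {h} is an open packing of
-- G □ K_r.  Upper bound: for r ≥ 3 two vertices of an open packing P of G □ K_r never lie in
-- the same fibre {g} × K_r (a third vertex of the fibre would be a common neighbour), and two
-- vertices of P over adjacent vertices of G lie in the same layer; so the projection of P to G
-- is injective on P, and each of its vertices has at most one neighbour in it.
-- Equality: for a 2-independent S and a proper colouring c of G/S, {(x , c x) | x ∈ S} is an
-- open packing.  A common neighbour of (x , c x) and (y , c y) forces x ∼ y and c x ≠ c y,
-- impossible since x, y then lie in one component of G[S]; or it forces c x = c y and a
-- common neighbour of x and y in G, so x ≁ y (G is triangle-free), and since components of
-- G[S] are vertices or edges, x and y lie in distinct components at distance 2, adjacent in G/S.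
module Submission where

open import Defs
open import Data.Bool using (Bool; true; false; _∧_; _∨_)
open import Data.Fin using (Fin; zero; suc; combine; remQuot; fromℕ<; _≟_)
open import Data.Fin.Properties using (remQuot-combine; combine-remQuot; any?; 0≢1+n; suc-injective)
open import Data.Fin.Subset using (Subset; inside; outside; _∈_; _∩_; _-_; ∣_∣; ⊤)
open import Data.Fin.Subset.Properties using (_∈?_; x∈p∩q⁺; x∈p∩q⁻; ∈⊤; x∈p∧x≢y⇒x∈p-y; x∈p⇒∣p-x∣<∣p∣)
open import Data.List using ([]; _∷_; map; filter)
open import Data.List.Membership.Propositional using () renaming (_∈_ to _∈ₗ_)
open import Data.List.Membership.Propositional.Properties using (∈-map⁺; ∈-++⁺ˡ; ∈-++⁺ʳ)
open import Data.List.Relation.Unary.Any using () renaming (here to hereₗ; there to thereₗ)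
open import Data.Nat using (ℕ; zero; suc; _≤_; _<_; _*_; z≤n; s≤s)
open import Data.Nat.Properties using (≤-trans; ≤-antisym; ≤⇒≯; ⊔-lub; m≤m⊔n; m≤n⊔m; module ≤-Reasoning)
open import Data.Product using (_×_; _,_; proj₁; proj₂; uncurry; ∃-syntax)
open import Data.Sum using (_⊎_; inj₁; inj₂; [_,_])
open import Data.Vec using ([]; _∷_; here; there; tabulate)
open import Data.Vec.Properties using ([]=⇒lookup; lookup⇒[]=; lookup∘tabulate)
open import Function using (_∘_)
open import Level using (0ℓ)
open import Relation.Nullary using (¬_; yes; no; does; contradiction)
open import Relation.Nullary.Decidable using (dec-true; ⌊_⌋; decidable-stable; _×-dec_)
open import Relation.Unary using (Pred; Decidable)
open import Relation.Binary.PropositionalEquality using (_≡_; _≢_; refl; sym; trans; cong; cong₂; subst; module ≡-Reasoning)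

∈-tabulate⁺ : ∀ {m} (f : Fin m → Bool) {x} → f x ≡ true → x ∈ tabulate f
∈-tabulate⁺ f {x} fx = lookup⇒[]= x (tabulate f) (trans (lookup∘tabulate f x) fx)

∈-tabulate⁻ : ∀ {m} (f : Fin m → Bool) {x} → x ∈ tabulate f → f x ≡ true
∈-tabulate⁻ f {x} x∈ = trans (sym (lookup∘tabulate f x)) ([]=⇒lookup x∈)

subset : ∀ {m} {P : Pred (Fin m) 0ℓ} → Decidable P → Subset m
subset P? = tabulate (does ∘ P?)

∈-subset⁺ : ∀ {m} {P : Pred (Fin m) 0ℓ} (P? : Decidable P) {x} → P x → x ∈ subset P?
∈-subset⁺ P? {x} px = ∈-tabulate⁺ (does ∘ P?) (dec-true (P? x) px)

∈-subset⁻ : ∀ {m} {P : Pred (Fin m) 0ℓ} (P? : Decidable P) {x} → x ∈ subset P? → P x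
∈-subset⁻ P? {x} x∈ with P? x | ∈-tabulate⁻ (does ∘ P?) x∈
... | yes px | _ = px

injectiveOn⇒∣p∣≤∣q∣ : ∀ {m n} {p : Subset m} {q : Subset n} (f : Fin m → Fin n) →
  (∀ {i} → i ∈ p → f i ∈ q) → (∀ {i j} → i ∈ p → j ∈ p → f i ≡ f j → i ≡ j) →
  ∣ p ∣ ≤ ∣ q ∣
injectiveOn⇒∣p∣≤∣q∣ {p = []} f maps inj = z≤n
injectiveOn⇒∣p∣≤∣q∣ {p = outside ∷ p} f maps inj =
  injectiveOn⇒∣p∣≤∣q∣ (f ∘ suc) (maps ∘ there)
    (λ i∈ j∈ eq → suc-injective (inj (there i∈) (there j∈) eq))
injectiveOn⇒∣p∣≤∣q∣ {p = inside ∷ p} {q} f maps inj = begin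
  suc ∣ p ∣          ≤⟨ s≤s (injectiveOn⇒∣p∣≤∣q∣ (f ∘ suc) maps′ inj′) ⟩
  suc ∣ q - f zero ∣ ≤⟨ x∈p⇒∣p-x∣<∣p∣ (maps here) ⟩
  ∣ q ∣              ∎
  where
  open ≤-Reasoning
  maps′ : ∀ {i} → i ∈ p → f (suc i) ∈ q - f zero
  maps′ i∈ = x∈p∧x≢y⇒x∈p-y (maps (there i∈)) (λ eq → 0≢1+n (inj here (there i∈) (sym eq)))
  inj′ : ∀ {i j} → i ∈ p → j ∈ p → f (suc i) ≡ f (suc j) → i ≡ j
  inj′ i∈ j∈ eq = suc-injective (inj (there i∈) (there j∈) eq)

subsingleton⇒∣p∣≤1 : ∀ {m} {p : Subset m} → (∀ {a b} → a ∈ p → b ∈ p → a ≡ b) → ∣ p ∣ ≤ 1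
subsingleton⇒∣p∣≤1 unique = injectiveOn⇒∣p∣≤∣q∣ {q = ⊤ {1}} (λ _ → zero) (λ _ → ∈⊤) (λ a∈ b∈ _ → unique a∈ b∈)

x∈p∧y∈p∧x≢y⇒2≤∣p∣ : ∀ {m} {p : Subset m} {x y} → x ∈ p → y ∈ p → x ≢ y → 2 ≤ ∣ p ∣
x∈p∧y∈p∧x≢y⇒2≤∣p∣ {p = p} {x} {y} x∈p y∈p x≢y = begin
  2               ≤⟨ s≤s (≤-trans (s≤s z≤n) (x∈p⇒∣p-x∣<∣p∣ y∈p-x)) ⟩
  suc ∣ p - x ∣   ≤⟨ x∈p⇒∣p-x∣<∣p∣ x∈p ⟩
  ∣ p ∣           ∎
  where
  open ≤-Reasoning
  y∈p-x : y ∈ p - x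
  y∈p-x = x∈p∧x≢y⇒x∈p-y y∈p (x≢y ∘ sym)

∈-allSubsets : ∀ n (p : Subset n) → p ∈ₗ allSubsets n
∈-allSubsets zero    []          = hereₗ refl
∈-allSubsets (suc n) (true ∷ p)  = ∈-++⁺ˡ (∈-map⁺ (true ∷_) (∈-allSubsets n p))
∈-allSubsets (suc n) (false ∷ p) =
  ∈-++⁺ʳ (map (true ∷_) (allSubsets n)) (∈-map⁺ (false ∷_) (∈-allSubsets n p))

maxSize : ∀ {n} {Q : Pred (Subset n) 0ℓ} → Decidable Q → ℕ
maxSize {n} Q? = maxList (map ∣_∣ (filter Q? (allSubsets n)))

module _ {n} {Q : Pred (Subset n) 0ℓ} (Q? : Decidable Q) where

  private
    ≤-maxList-filter : ∀ xs {p} → p ∈ₗ xs → Q p → ∣ p ∣ ≤ maxList (map ∣_∣ (filter Q? xs))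
    ≤-maxList-filter (x ∷ xs) (hereₗ refl) qp with Q? x
    ... | yes _ = m≤m⊔n _ _
    ... | no ¬q = contradiction qp ¬q
    ≤-maxList-filter (x ∷ xs) (thereₗ p∈) qp with Q? x
    ... | yes _ = ≤-trans (≤-maxList-filter xs p∈ qp) (m≤n⊔m ∣ x ∣ _)
    ... | no _  = ≤-maxList-filter xs p∈ qp

    maxList-filter-≤ : ∀ xs {k} → (∀ p → Q p → ∣ p ∣ ≤ k) → maxList (map ∣_∣ (filter Q? xs)) ≤ k
    maxList-filter-≤ []       bound = z≤n
    maxList-filter-≤ (x ∷ xs) bound with Q? x
    ... | yes qx = ⊔-lub (bound x qx) (maxList-filter-≤ xs bound)
    ... | no _   = maxList-filter-≤ xs bound

  ≤-maxSize : ∀ {p} → Q p → ∣ p ∣ ≤ maxSize Q?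
  ≤-maxSize {p} = ≤-maxList-filter (allSubsets n) (∈-allSubsets n p)

  maxSize-≤ : ∀ {k} → (∀ p → Q p → ∣ p ∣ ≤ k) → maxSize Q? ≤ k
  maxSize-≤ = maxList-filter-≤ (allSubsets n)

module _ {n} {G : Graph n} (simple : IsSimple G) where

  adjacent-sym : ∀ {x y} → G x y ≡ true → G y x ≡ true
  adjacent-sym {x} {y} xy = trans (IsSimple.sym simple y x) xy

  adjacent⇒≢ : ∀ {x y} → G x y ≡ true → x ≢ y
  adjacent⇒≢ {x} xy refl with trans (sym xy) (IsSimple.irrefl simple x)
  ... | ()

module _ {n} {G : Graph n} {S : Subset n} where

  reach-start : ∀ {x y} → Reach G S x y → x ∈ S
  reach-start (here x∈S)     = x∈S
  reach-start (step x∈S _ _) = x∈S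

  reach-end : ∀ {x y} → Reach G S x y → y ∈ S
  reach-end (here x∈S)       = x∈S
  reach-end (step _ _ x⇝y)   = reach-end x⇝y

  reach-trans : ∀ {x y z} → Reach G S x y → Reach G S y z → Reach G S x z
  reach-trans (here _)           y⇝z = y⇝z
  reach-trans (step x∈S xw w⇝y) y⇝z = step x∈S xw (reach-trans w⇝y y⇝z)

  withinDist1⇒reach : ∀ {a b} → a ∈ S → b ∈ S → WithinDist G a b 1 → Reach G S a b
  withinDist1⇒reach a∈S b∈S here           = here a∈S
  withinDist1⇒reach a∈S b∈S (step ab here) = step a∈S ab (here b∈S)

module _ {n} {G : Graph n} (simple : IsSimple G) {S : Subset n} where

  reach-sym : ∀ {x y} → Reach G S x y → Reach G S y x
  reach-sym (here x∈S) = here x∈S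
  reach-sym (step {w = w} x∈S xw w⇝y) =
    reach-trans (reach-sym w⇝y) (step (reach-start w⇝y) (adjacent-sym simple xw) (here x∈S))

  reach-across : ∀ {x y a b} → Reach G S x a → Reach G S y b → WithinDist G a b 1 → Reach G S x y
  reach-across x⇝a y⇝b ab =
    reach-trans x⇝a (reach-trans (withinDist1⇒reach (reach-end x⇝a) (reach-end y⇝b) ab) (reach-sym y⇝b))

  reach⇒≡⊎adjacent : Is2Independent G S → ∀ {x y} → Reach G S x y → x ≡ y ⊎ G x y ≡ true
  reach⇒≡⊎adjacent indep (here _) = inj₁ refl
  reach⇒≡⊎adjacent indep {x} {y} (step {w = w} x∈S xw w⇝y) with reach⇒≡⊎adjacent indep w⇝y
  ... | inj₁ refl = inj₂ xw
  ... | inj₂ wy   = inj₁ (decidable-stable (x ≟ y) λ x≢y →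
    ≤⇒≯ (x∈p∧y∈p∧x≢y⇒2≤∣p∣ x∈N[w]∩S y∈N[w]∩S x≢y) (indep w (reach-start w⇝y)))
    where
    x∈N[w]∩S : x ∈ N G w ∩ S
    x∈N[w]∩S = x∈p∩q⁺ (∈-tabulate⁺ (G w) (adjacent-sym simple xw) , x∈S)
    y∈N[w]∩S : y ∈ N G w ∩ S
    y∈N[w]∩S = x∈p∩q⁺ (∈-tabulate⁺ (G w) wy , reach-end w⇝y)

  components-apart : Is2Independent G S → ∀ {x y} → x ≢ y → G x y ≡ false →
    ¬ (∃[ a ] ∃[ b ] (Reach G S x a × Reach G S y b × WithinDist G a b 1))
  components-apart indep x≢y x≁y (_ , _ , x⇝a , y⇝b , ab)
    with reach⇒≡⊎adjacent indep (reach-across x⇝a y⇝b ab)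
  ... | inj₁ x≡y = x≢y x≡y
  ... | inj₂ x∼y = contradiction (trans (sym x≁y) x∼y) λ ()

  commonNeighbour⇒QuotAdj : Is2Independent G S → ∀ {x y z} → x ∈ S → y ∈ S → x ≢ y →
    G x y ≡ false → G x z ≡ true → G y z ≡ true → QuotAdj G S x y
  commonNeighbour⇒QuotAdj indep x∈S y∈S x≢y x≁y xz yz =
    (_ , _ , here x∈S , here y∈S , step xz (step (adjacent-sym simple yz) here)) ,
    components-apart indep x≢y x≁y

HasThirdElement : ℕ → Set
HasThirdElement r = ∀ (a b : Fin r) → ∃[ c ] (c ≢ a × c ≢ b)

2<⇒hasThirdElement : ∀ {r} → 2 < r → HasThirdElement r
2<⇒hasThirdElement (s≤s (s≤s (s≤s _))) zero          zero          = suc zero , (λ ()) , (λ ())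
2<⇒hasThirdElement (s≤s (s≤s (s≤s _))) zero          (suc zero)    = suc (suc zero) , (λ ()) , (λ ())
2<⇒hasThirdElement (s≤s (s≤s (s≤s _))) zero          (suc (suc _)) = suc zero , (λ ()) , (λ ())
2<⇒hasThirdElement (s≤s (s≤s (s≤s _))) (suc zero)    zero          = suc (suc zero) , (λ ()) , (λ ())
2<⇒hasThirdElement (s≤s (s≤s (s≤s _))) (suc zero)    (suc _)       = zero , (λ ()) , (λ ())
2<⇒hasThirdElement (s≤s (s≤s (s≤s _))) (suc (suc _)) zero          = suc zero , (λ ()) , (λ ())
2<⇒hasThirdElement (s≤s (s≤s (s≤s _))) (suc (suc _)) (suc _)       = zero , (λ ()) , (λ ())

module CartesianProduct {n r : ℕ} (G : Graph n) where

  fst : Fin (n * r) → Fin n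
  fst i = proj₁ (remQuot {n} r i)

  snd : Fin (n * r) → Fin r
  snd i = proj₂ (remQuot {n} r i)

  fst-combine : ∀ g h → fst (combine g h) ≡ g
  fst-combine g h = cong proj₁ (remQuot-combine {n} {r} g h)

  snd-combine : ∀ g h → snd (combine g h) ≡ h
  snd-combine g h = cong proj₂ (remQuot-combine {n} {r} g h)

  ≡-by-coordinates : ∀ {i j} → fst i ≡ fst j → snd i ≡ snd j → i ≡ j
  ≡-by-coordinates {i} {j} fst≡ snd≡ = begin
    i                          ≡⟨ combine-remQuot {n} r i ⟨
    combine (fst i) (snd i)    ≡⟨ cong₂ combine fst≡ snd≡ ⟩
    combine (fst j) (snd j)    ≡⟨ combine-remQuot {n} r j ⟩
    j                          ∎
    where open ≡-Reasoning

  data Edge (i j : Fin (n * r)) : Set where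
    fibre : fst i ≡ fst j → snd i ≢ snd j → Edge i j
    layer : snd i ≡ snd j → G (fst i) (fst j) ≡ true → Edge i j

  private
    pairEdge⁻ : ∀ {g g′ : Fin n} {h h′ : Fin r} →
      (⌊ g ≟ g′ ⌋ ∧ K r h h′) ∨ (⌊ h ≟ h′ ⌋ ∧ G g g′) ≡ true →
      (g ≡ g′ × h ≢ h′) ⊎ (h ≡ h′ × G g g′ ≡ true)
    pairEdge⁻ {g} {g′} {h} {h′} adj with g ≟ g′ | h ≟ h′
    ... | yes g≡g′ | no h≢h′ = inj₁ (g≡g′ , h≢h′)
    ... | yes _    | yes h≡h′ = inj₂ (h≡h′ , adj)
    ... | no _     | yes h≡h′ = inj₂ (h≡h′ , adj)

    pairEdge⁺ : ∀ {g g′ : Fin n} {h h′ : Fin r} →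
      (g ≡ g′ × h ≢ h′) ⊎ (h ≡ h′ × G g g′ ≡ true) →
      (⌊ g ≟ g′ ⌋ ∧ K r h h′) ∨ (⌊ h ≟ h′ ⌋ ∧ G g g′) ≡ true
    pairEdge⁺ {g} {g′} {h} {h′} e with g ≟ g′ | h ≟ h′ | e
    ... | yes _   | no _     | _                 = refl
    ... | no g≢g′ | _        | inj₁ (g≡g′ , _)   = contradiction g≡g′ g≢g′
    ... | _       | yes h≡h′ | inj₁ (_ , h≢h′)   = contradiction h≡h′ h≢h′
    ... | _       | no h≢h′  | inj₂ (h≡h′ , _)   = contradiction h≡h′ h≢h′
    ... | yes _   | yes _    | inj₂ (_ , adj)    = adj
    ... | no _    | yes _    | inj₂ (_ , adj)    = adj

  edge⁻ : ∀ {i j} → (G □ K r) i j ≡ true → Edge i j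
  edge⁻ {i} {j} adj = [ uncurry fibre , uncurry layer ] (pairEdge⁻ {fst i} {fst j} {snd i} {snd j} adj)

  edge⁺ : ∀ {i j} → Edge i j → (G □ K r) i j ≡ true
  edge⁺ {i} {j} (fibre fst≡ snd≢) = pairEdge⁺ {fst i} {fst j} {snd i} {snd j} (inj₁ (fst≡ , snd≢))
  edge⁺ {i} {j} (layer snd≡ adj)  = pairEdge⁺ {fst i} {fst j} {snd i} {snd j} (inj₂ (snd≡ , adj))

  onGraphOver? : ∀ (c : Fin n → Fin r) S → Decidable (λ i → fst i ∈ S × snd i ≡ c (fst i))
  onGraphOver? c S i = (fst i ∈? S) ×-dec (snd i ≟ c (fst i))

  lift : (Fin n → Fin r) → Subset n → Subset (n * r)
  lift c S = subset (onGraphOver? c S)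

  ∈-lift⁺ : ∀ c S {i} → fst i ∈ S → snd i ≡ c (fst i) → i ∈ lift c S
  ∈-lift⁺ c S fst∈S snd≡ = ∈-subset⁺ (onGraphOver? c S) (fst∈S , snd≡)

  ∈-lift⁻ : ∀ c S {i} → i ∈ lift c S → fst i ∈ S × snd i ≡ c (fst i)
  ∈-lift⁻ c S = ∈-subset⁻ (onGraphOver? c S)

  ∣S∣≤∣lift∣ : ∀ c S → ∣ S ∣ ≤ ∣ lift c S ∣
  ∣S∣≤∣lift∣ c S = injectiveOn⇒∣p∣≤∣q∣ (λ x → combine x (c x)) maps inj
    where
    maps : ∀ {x} → x ∈ S → combine x (c x) ∈ lift c S
    maps {x} x∈S = ∈-lift⁺ c S (subst (_∈ S) (sym (fst-combine x (c x))) x∈S)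
      (trans (snd-combine x (c x)) (cong c (sym (fst-combine x (c x)))))
    inj : ∀ {x y} → x ∈ S → y ∈ S → combine x (c x) ≡ combine y (c y) → x ≡ y
    inj {x} {y} _ _ eq = trans (sym (fst-combine x (c x))) (trans (cong fst eq) (fst-combine y (c y)))

  lift-fst-injective : ∀ c S {u v} → u ∈ lift c S → v ∈ lift c S → fst u ≡ fst v → u ≡ v
  lift-fst-injective c S u∈ v∈ fst≡ with ∈-lift⁻ c S u∈ | ∈-lift⁻ c S v∈
  ... | _ , snd-u | _ , snd-v = ≡-by-coordinates fst≡ (trans snd-u (trans (cong c fst≡) (sym snd-v)))

  lift-openPacking : ∀ c S →
    (∀ {x y} → x ∈ S → y ∈ S → G x y ≡ true → c x ≡ c y) →
    (∀ {x y z} → x ∈ S → y ∈ S → x ≢ y → G x z ≡ true → G y z ≡ true → c x ≢ c y) →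
    IsOpenPacking (G □ K r) (lift c S)
  lift-openPacking c S constant separating u v u∈ v∈ u≢v w uw vw
    with ∈-lift⁻ c S u∈ | ∈-lift⁻ c S v∈ | edge⁻ uw | edge⁻ vw
  ... | _ | _ | fibre fu≡fw _ | fibre fv≡fw _ =
    u≢v (lift-fst-injective c S u∈ v∈ (trans fu≡fw (sym fv≡fw)))
  ... | fu∈S , snd-u | fv∈S , snd-v | fibre fu≡fw su≢sw | layer sv≡sw vw′ =
    su≢sw (trans snd-u (trans (sym (constant fv∈S fu∈S vu)) (trans (sym snd-v) sv≡sw)))
    where vu = subst (λ z → G (fst v) z ≡ true) (sym fu≡fw) vw′
  ... | fu∈S , snd-u | fv∈S , snd-v | layer su≡sw uw′ | fibre fv≡fw sv≢sw =
    sv≢sw (trans snd-v (trans (sym (constant fu∈S fv∈S uv)) (trans (sym snd-u) su≡sw)))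
    where uv = subst (λ z → G (fst u) z ≡ true) (sym fv≡fw) uw′
  ... | fu∈S , snd-u | fv∈S , snd-v | layer su≡sw uw′ | layer sv≡sw vw′ =
    separating fu∈S fv∈S (u≢v ∘ lift-fst-injective c S u∈ v∈) uw′ vw′
      (trans (sym snd-u) (trans su≡sw (trans (sym sv≡sw) snd-v)))

  ρo≤ρo-□ : Fin r → ρo G ≤ ρo (G □ K r)
  ρo≤ρo-□ h = maxSize-≤ (isOpenPacking? G) λ P P-packing → ≤-trans (∣S∣≤∣lift∣ (λ _ → h) P)
    (≤-maxSize (isOpenPacking? (G □ K r))
      (lift-openPacking (λ _ → h) P (λ _ _ _ → refl)
        (λ x∈P y∈P x≢y xz yz _ → P-packing _ _ x∈P y∈P x≢y _ xz yz)))

  liesUnder? : ∀ P → Decidable (λ g → ∃[ i ] (i ∈ P × fst i ≡ g))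
  liesUnder? P g = any? (λ i → (i ∈? P) ×-dec (fst i ≟ g))

  project : Subset (n * r) → Subset n
  project P = subset (liesUnder? P)

  ∈-project⁺ : ∀ P {i} → i ∈ P → fst i ∈ project P
  ∈-project⁺ P {i} i∈P = ∈-subset⁺ (liesUnder? P) (i , i∈P , refl)

  ∈-project⁻ : ∀ P {g} → g ∈ project P → ∃[ i ] (i ∈ P × fst i ≡ g)
  ∈-project⁻ P = ∈-subset⁻ (liesUnder? P)

  module _ {P : Subset (n * r)} (packing : IsOpenPacking (G □ K r) P) where

    -- A third element c of K_r gives the common neighbour (fst u , c) of u and v.
    packing-fst-injective : HasThirdElement r → ∀ {u v} → u ∈ P → v ∈ P → fst u ≡ fst v → u ≡ v
    packing-fst-injective third {u} {v} u∈P v∈P fst≡ with third (snd u) (snd v)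
    ... | c , c≢su , c≢sv = decidable-stable (u ≟ v) λ u≢v →
      packing u v u∈P v∈P u≢v w
        (edge⁺ (fibre (sym fst-w) (λ su≡sw → c≢su (sym (trans su≡sw snd-w)))))
        (edge⁺ (fibre (trans (sym fst≡) (sym fst-w)) (λ sv≡sw → c≢sv (sym (trans sv≡sw snd-w)))))
      where
      w = combine (fst u) c
      fst-w = fst-combine (fst u) c
      snd-w = snd-combine (fst u) c

    packing-adjacent⇒sameLayer : IsSimple G → ∀ {u i} → u ∈ P → i ∈ P →
      G (fst u) (fst i) ≡ true → snd u ≡ snd i
    packing-adjacent⇒sameLayer simple {u} {i} u∈P i∈P ui = decidable-stable (snd u ≟ snd i) λ su≢si →
      packing u i u∈P i∈P (adjacent⇒≢ simple ui ∘ cong fst) w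
        (edge⁺ (fibre (sym fst-w) (λ su≡sw → su≢si (trans su≡sw snd-w))))
        (edge⁺ (layer (sym snd-w) (subst (λ z → G (fst i) z ≡ true) (sym fst-w) (adjacent-sym simple ui))))
      where
      w = combine (fst u) (snd i)
      fst-w = fst-combine (fst u) (snd i)
      snd-w = snd-combine (fst u) (snd i)

    project-2-independent : IsSimple G → Is2Independent G (project P)
    project-2-independent simple g g∈ =
      s≤s (subsingleton⇒∣p∣≤1 λ a∈ b∈ → unique (∈-project⁻ P g∈) (x∈p∩q⁻ _ _ a∈) (x∈p∩q⁻ _ _ b∈))
      where
      towards : ∀ {u i} → u ∈ P → i ∈ P → G (fst u) (fst i) ≡ true → (G □ K r) i u ≡ true
      towards u∈P i∈P ui = edge⁺ (layer (sym (packing-adjacent⇒sameLayer simple u∈P i∈P ui)) (adjacent-sym simple ui))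
      unique : ∀ {a b} → ∃[ u ] (u ∈ P × fst u ≡ g) →
        a ∈ N G g × a ∈ project P → b ∈ N G g × b ∈ project P → a ≡ b
      unique (u , u∈P , refl) (ga , a∈) (gb , b∈) with ∈-project⁻ P a∈ | ∈-project⁻ P b∈
      ... | i , i∈P , refl | j , j∈P , refl = decidable-stable (fst i ≟ fst j) λ fi≢fj →
        packing i j i∈P j∈P (fi≢fj ∘ cong fst) u
          (towards u∈P i∈P (∈-tabulate⁻ (G (fst u)) ga))
          (towards u∈P j∈P (∈-tabulate⁻ (G (fst u)) gb))

    ∣P∣≤∣project∣ : HasThirdElement r → ∣ P ∣ ≤ ∣ project P ∣
    ∣P∣≤∣project∣ third = injectiveOn⇒∣p∣≤∣q∣ fst (∈-project⁺ P) (packing-fst-injective third)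

  ρo-□≤α₂ : IsSimple G → HasThirdElement r → ρo (G □ K r) ≤ α₂ G
  ρo-□≤α₂ simple third = maxSize-≤ (isOpenPacking? (G □ K r)) λ P packing →
    ≤-trans (∣P∣≤∣project∣ packing third) (≤-maxSize (is2Independent? G) (project-2-independent packing simple))

  ∣S∣≤ρo-□ : IsSimple G → TriangleFree G → ∀ {S} → Is2Independent G S → χQuot≤ G S r →
    ∣ S ∣ ≤ ρo (G □ K r)
  ∣S∣≤ρo-□ simple triangle-free {S} indep colouring =
    ≤-trans (∣S∣≤∣lift∣ colour S) (≤-maxSize (isOpenPacking? (G □ K r)) (lift-openPacking colour S constant separating))
    where
    open QuotColouring colouring
    constant : ∀ {x y} → x ∈ S → y ∈ S → G x y ≡ true → colour x ≡ colour y
    constant x∈S y∈S xy = wellDef _ _ (step x∈S xy (here y∈S))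
    separating : ∀ {x y z} → x ∈ S → y ∈ S → x ≢ y → G x z ≡ true → G y z ≡ true → colour x ≢ colour y
    separating {x} {y} {z} x∈S y∈S x≢y xz yz with G x y in xy
    ... | true  = contradiction (x , y , z , xy , yz , xz) triangle-free
    ... | false = proper x y x∈S y∈S (commonNeighbour⇒QuotAdj simple indep x∈S y∈S x≢y xy xz yz)

theorem4 : ∀ {n : ℕ} (G : Graph n) → IsSimple G → (r : ℕ) → 2 < r →
    (ρo G ≤ ρo (G □ K r) × ρo (G □ K r) ≤ α₂ G)
    × (∀ (S : Subset n) → Isα₂Set G S → TriangleFree G → χQuot≤ G S r →
         ρo (G □ K r) ≡ α₂ G)
theorem4 G simple r 2<r = (ρo≤ρo-□ (fromℕ< (≤-trans (s≤s z≤n) 2<r)) , upper) , equality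
  where
  open CartesianProduct {r = r} G
  upper : ρo (G □ K r) ≤ α₂ G
  upper = ρo-□≤α₂ simple (2<⇒hasThirdElement 2<r)
  equality : ∀ S → Isα₂Set G S → TriangleFree G → χQuot≤ G S r → ρo (G □ K r) ≡ α₂ G
  equality S (indep , ∣S∣≡α₂) triangle-free colouring =
    ≤-antisym upper (subst (_≤ ρo (G □ K r)) ∣S∣≡α₂ (∣S∣≤ρo-□ simple triangle-free indep colouring))
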